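{- Let $\alpha\in\mathcal{C}_n$, $i\in[n-1]$ and $z\in[n-i-\alpha_i]$. Then: (i) $\alpha$ is $(i,z)$-insertable if and only if $c_{i,\widehat J(i,z)}(\alpha)=\alpha_i-\alpha_{\widehat J(i,z)}+z-1$; (ii) if $\alpha$ is $(i,z)$-insertable then $z\leqslant\alpha_{k_{\alpha^*}(i)}-\alpha_i+k_{\alpha^*}(i)-i$, where $k_{\alpha^*}(i)=\min\{k>i:\alpha^*_k<\alpha^*_i\}$; (iii) if $\alpha_i+i<n$ then $\alpha$ is $(i,1)$-insertable.
   Context: $[n]=\{1,\dots,n\}$. A (weak) composition is a finite sequence of nonnegative integers $(\alpha_1,\dots,\alpha_m)$ with $\alpha_k=0$ for $k>m$; $|\alpha|=\sum\alpha_k$. $\mathcal{C}_n$ is the set of compositions $(\alpha_1,\dots,\alpha_{n-1})$ with $0\leqslant\alpha_i\leqslant n-i$. For $\alpha\in\mathcal{C}_n$, $\alpha^*\in\mathcal{C}_n$ is defined by $\alpha^*_i=n-i-\alpha_i$ for $i\in[n-1]$. For a composition $\alpha$, a positive integer $i$ and $j\in\mathbb{N}$: $c_{i,j}(\alpha)=0$ if $j\leqslant i+1$; for $j>i+1$, $c_{i,j}(\alpha)=c_{i,j-1}(\alpha)+1$ if $\alpha_{j-1}<\alpha_i-c_{i,j-1}(\alpha)$ and $c_{i,j}(\alpha)=c_{i,j-1}(\alpha)$ otherwise. For compositions with $|\alpha|=|\alpha'|+1$, $\alpha$ covers $\alpha'$ if there are positive integers $i<j$ with: (a1) $\alpha'_i\leqslant\alpha_i-1$;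 (a2) $\alpha'_j=\alpha_j+\alpha_i-\alpha'_i-1$; (a3) $\alpha'_k=\alpha_k$ for $k\neq i,j$; (a4) $c_{i,j}(\alpha)=c_{i,j}(\alpha')=\alpha'_i-\alpha_j$. For $\alpha\in\mathcal{C}_n$, $i\in[n-1]$, $z\in[n-i-\alpha_i]$: $\alpha$ is $(i,z)$-insertable if there exists $\alpha''\in\mathcal{C}_n$ with $\alpha''_i=\alpha_i+z$ such that $\alpha''$ covers $\alpha$. Let $\widehat\alpha$ be given by $\widehat\alpha_i=\alpha_i+z$, $\widehat\alpha_m=\alpha_m$ for $m\neq i$, and $\widehat J(i,z)=\max\{j>i:c_{i,j}(\alpha)=c_{i,j}(\widehat\alpha)\}$. -}

module Defs where

open import Data.Nat using (ℕ; zero; suc; _+_; _∸_; _≤_; _<_; _≤ᵇ_; _<ᵇ_)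
open import Data.Bool using (if_then_else_)
open import Data.List using (List; []; _∷_; length; map; upTo)
open import Data.Nat.ListAction using (sum)
open import Data.Product using (Σ; ∃; _×_)
open import Relation.Binary.PropositionalEquality using (_≡_; _≢_)

-- A (weak) composition is a finite sequence of naturals, stored as a list
-- (α₁, …, α_m); entries are 1-indexed and α_k = 0 for k > m (and for k = 0,
-- which is never used as a position).
Composition : Set
Composition = List ℕ

at : Composition → ℕ → ℕ
at []       _             = 0
at (a ∷ as) zero          = 0
at (a ∷ as) (suc zero)    = a
at (a ∷ as) (suc (suc k)) = at as (suc k)

∣_∣ : Composition → ℕ
∣ α ∣ = sum α

record InC (n : ℕ) (α : Composition) : Set where
  field
    len   : length α ≡ n ∸ 1
    bound : ∀ i → 1 ≤ i → i ≤ n ∸ 1 → at α i ≤ n ∸ i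

star : ℕ → Composition → Composition
star n α = map (λ k → n ∸ k ∸ at α k) (map suc (upTo (n ∸ 1)))

c : ℕ → ℕ → Composition → ℕ
c i zero    α = 0
c i (suc j) α =
  if suc j ≤ᵇ suc i then 0
  else (if at α j <ᵇ (at α i ∸ c i j α) then suc (c i j α) else c i j α)

-- α covers α' (conditions (a1)–(a4)); integer equations written additively.
Covers : Composition → Composition → Set
Covers α α' =
  ∣ α ∣ ≡ suc ∣ α' ∣ ×
  Σ ℕ λ i → Σ ℕ λ j →
    1 ≤ i × i < j ×
    suc (at α' i) ≤ at α i ×
    at α' j + at α' i + 1 ≡ at α j + at α i ×
    (∀ k → 1 ≤ k → k ≢ i → k ≢ j → at α' k ≡ at α k) ×
    (c i j α ≡ c i j α' × c i j α' + at α j ≡ at α' i)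

Insertable : ℕ → Composition → ℕ → ℕ → Set
Insertable n α i z =
  Σ Composition λ α'' → InC n α'' × at α'' i ≡ at α i + z × Covers α'' α

addAt : Composition → ℕ → ℕ → Composition
addAt []       _             z = []
addAt (a ∷ as) zero          z = a ∷ as
addAt (a ∷ as) (suc zero)    z = (a + z) ∷ as
addAt (a ∷ as) (suc (suc k)) z = a ∷ addAt as (suc k) z

IsJhat : Composition → ℕ → ℕ → ℕ → Set
IsJhat α i z J =
  (i < J × c i J α ≡ c i J (addAt α i z)) ×
  (∀ j → i < j → c i j α ≡ c i j (addAt α i z) → j ≤ J)

IsKstar : ℕ → Composition → ℕ → ℕ → Set
IsKstar n α i k =
  (i < k × at (star n α) k < at (star n α) i) ×
  (∀ k' → i < k' → at (star n α) k' < at (star n α) i → k ≤ k')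

{-# OPTIONS --safe #-}
-- Write α̂ for α with α_i raised by z. The counters satisfy c_{i,m}(α) ≤ c_{i,m}(α̂) ≤ c_{i,m}(α) + z;
-- they agree until the first m > i at which α_m + c_{i,m}(α) lies in the window [α_i, α_i + z), and
-- differ from then on. A composition covering α with i-th entry α_i + z exists exactly when some j > i
-- has agreeing counters and c_{i,j}(α) + α_j + 1 = α_i + z (raise α_i by z, lower α_j by z − 1).
-- Such a j lies in the window, so it is the last index of agreement Ĵ(i,z); this is (i).
-- Before k_{α*}(i) every step of c_{i,·} increments it, which confines j and gives (ii).
-- For z = 1 the window is the single value α_i, and a search along m finds it, giving (iii).
module Submission where

open import Defs
open import Data.Nat
open import Data.Nat.Properties
open import Data.Bool using (true; false; if_then_else_)
open import Data.List using ([]; _∷_; length; map; applyUpTo)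
open import Data.Nat.ListAction using (sum)
open import Data.Product using (Σ; _×_; _,_; proj₁; proj₂)
open import Data.Sum using (_⊎_; inj₁; inj₂)
open import Function using (_∘_; id)
open import Relation.Binary.Definitions using (tri<; tri≈; tri>)
open import Relation.Nullary using (yes; no; contradiction)
open import Relation.Nullary.Reflects using (ofʸ; ofⁿ)
open import Relation.Binary.PropositionalEquality
open import Function.Bundles using (_⇔_; mk⇔)
open import Data.Nat.Tactic.RingSolver using (solve-∀)

setAt : Composition → ℕ → ℕ → Composition
setAt []       _             v = []
setAt (a ∷ as) zero          v = a ∷ as
setAt (a ∷ as) (suc zero)    v = v ∷ as
setAt (a ∷ as) (suc (suc k)) v = a ∷ setAt as (suc k) v

addAt≡setAt : ∀ α i z → addAt α i z ≡ setAt α i (at α i + z)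
addAt≡setAt []       _             z = refl
addAt≡setAt (a ∷ as) zero          z = refl
addAt≡setAt (a ∷ as) (suc zero)    z = refl
addAt≡setAt (a ∷ as) (suc (suc k)) z = cong (a ∷_) (addAt≡setAt as (suc k) z)

at-beyond-length : ∀ α {m} → length α < m → at α m ≡ 0
at-beyond-length []       _ = refl
at-beyond-length (a ∷ as) {zero}        _ = refl
at-beyond-length (a ∷ as) {suc zero}    (s≤s ())
at-beyond-length (a ∷ as) {suc (suc m)} (s≤s lt) = at-beyond-length as lt

length-setAt : ∀ α k v → length (setAt α k v) ≡ length α
length-setAt []       _             v = refl
length-setAt (a ∷ as) zero          v = refl
length-setAt (a ∷ as) (suc zero)    v = refl
length-setAt (a ∷ as) (suc (suc k)) v = cong suc (length-setAt as (suc k) v)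

at-setAt-≢ : ∀ α k v {m} → m ≢ k → at (setAt α k v) m ≡ at α m
at-setAt-≢ []       _             v _ = refl
at-setAt-≢ (a ∷ as) zero          v _ = refl
at-setAt-≢ (a ∷ as) (suc zero)    v {zero}        _ = refl
at-setAt-≢ (a ∷ as) (suc zero)    v {suc zero}    m≢k = contradiction refl m≢k
at-setAt-≢ (a ∷ as) (suc zero)    v {suc (suc m)} _ = refl
at-setAt-≢ (a ∷ as) (suc (suc k)) v {zero}        _ = refl
at-setAt-≢ (a ∷ as) (suc (suc k)) v {suc zero}    _ = refl
at-setAt-≢ (a ∷ as) (suc (suc k)) v {suc (suc m)} m≢k =
  at-setAt-≢ as (suc k) v (m≢k ∘ cong suc)

-- Positions beyond the stored list cannot be written, so there only v = 0 is faithfully stored.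
at-setAt-≡ : ∀ α k v → 1 ≤ k → (length α < k → v ≡ 0) → at (setAt α k v) k ≡ v
at-setAt-≡ []       (suc k)       v _ v≡0 = sym (v≡0 (s≤s z≤n))
at-setAt-≡ (a ∷ as) (suc zero)    v _ _   = refl
at-setAt-≡ (a ∷ as) (suc (suc k)) v _ v≡0 = at-setAt-≡ as (suc k) v (s≤s z≤n) (v≡0 ∘ s≤s)

sum-setAt : ∀ α k v → 1 ≤ k → (length α < k → v ≡ 0) → sum (setAt α k v) + at α k ≡ sum α + v
sum-setAt []       (suc k)       v _ v≡0 = sym (v≡0 (s≤s z≤n))
sum-setAt (a ∷ as) (suc zero)    v _ _   = swap v (sum as) a
  where
  swap : ∀ v s a → v + s + a ≡ a + s + v
  swap = solve-∀
sum-setAt (a ∷ as) (suc (suc k)) v _ v≡0 = begin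
  a + sum (setAt as (suc k) v) + at as (suc k)   ≡⟨ +-assoc a _ _ ⟩
  a + (sum (setAt as (suc k) v) + at as (suc k)) ≡⟨ cong (a +_) (sum-setAt as (suc k) v (s≤s z≤n) (v≡0 ∘ s≤s)) ⟩
  a + (sum as + v)                               ≡⟨ +-assoc a _ _ ⟨
  a + sum as + v                                 ∎
  where open ≡-Reasoning

at-addAt-≡ : ∀ α {i} z → 1 ≤ i → i ≤ length α → at (addAt α i z) i ≡ at α i + z
at-addAt-≡ α {i} z 1≤i i≤len rewrite addAt≡setAt α i z =
  at-setAt-≡ α i (at α i + z) 1≤i (λ len<i → contradiction i≤len (<⇒≱ len<i))

at-addAt-≢ : ∀ α i z {m} → m ≢ i → at (addAt α i z) m ≡ at α m
at-addAt-≢ α i z m≢i rewrite addAt≡setAt α i z = at-setAt-≢ α i (at α i + z) m≢i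

length-addAt : ∀ α i z → length (addAt α i z) ≡ length α
length-addAt α i z rewrite addAt≡setAt α i z = length-setAt α i (at α i + z)

sum-addAt : ∀ α {i} z → 1 ≤ i → i ≤ length α → sum (addAt α i z) ≡ sum α + z
sum-addAt α {i} z 1≤i i≤len rewrite addAt≡setAt α i z = +-cancelʳ-≡ (at α i) _ _ (begin
  sum (setAt α i (at α i + z)) + at α i  ≡⟨ sum-setAt α i _ 1≤i (λ len<i → contradiction i≤len (<⇒≱ len<i)) ⟩
  sum α + (at α i + z)                   ≡⟨ regroup (sum α) (at α i) z ⟩
  sum α + z + at α i                     ∎)
  where
  open ≡-Reasoning
  regroup : ∀ s a z → s + (a + z) ≡ s + z + a
  regroup = solve-∀

0<m∸n⇒n<m : ∀ {m n} → 0 < m ∸ n → n < m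
0<m∸n⇒n<m 0<m∸n = m∸n≢0⇒n<m (m>n⇒m∸n≢0 0<m∸n)

advance : ℕ → ℕ → ℕ → ℕ
advance x y w = if x <ᵇ y ∸ w then suc w else w

advance-< : ∀ x {y w} → x + w < y → advance x y w ≡ suc w
advance-< x {y} {w} x+w<y with x <ᵇ y ∸ w | <ᵇ-reflects-< x (y ∸ w)
... | true  | _        = refl
... | false | ofⁿ x≮y∸w = contradiction (m+n≤o⇒m≤o∸n (suc x) x+w<y) x≮y∸w

advance-≥ : ∀ x {y w} → y ≤ x + w → advance x y w ≡ w
advance-≥ x {y} {w} y≤x+w with x <ᵇ y ∸ w | <ᵇ-reflects-< x (y ∸ w)
... | false | _        = refl
... | true  | ofʸ x<y∸w = contradiction y≤x+w (<⇒≱ (m≤o∸n⇒m+n≤o (suc x) w≤y x<y∸w))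
  where
  w≤y : w ≤ y
  w≤y = <⇒≤ (0<m∸n⇒n<m (≤-trans (s≤s z≤n) x<y∸w))

advance-≤ : ∀ x {y w} → w ≤ y → advance x y w ≤ y
advance-≤ x {y} {w} w≤y with x + w <? y
... | yes x+w<y = subst (_≤ y) (sym (advance-< x x+w<y)) (≤-trans (s≤s (m≤n+m w x)) x+w<y)
... | no  x+w≮y = subst (_≤ y) (sym (advance-≥ x (≮⇒≥ x+w≮y))) w≤y

c-below : ∀ {i m} β → m ≤ i → c i (suc m) β ≡ 0
c-below {i} {m} β m≤i with m <ᵇ suc i | <ᵇ-reflects-< m (suc i)
... | true  | _          = refl
... | false | ofⁿ m≮1+i = contradiction (s≤s m≤i) m≮1+i

c-suc : ∀ {i m} β → i < m → c i (suc m) β ≡ advance (at β m) (at β i) (c i m β)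
c-suc {i} {m} β i<m with m <ᵇ suc i | <ᵇ-reflects-< m (suc i)
... | false | _        = refl
... | true  | ofʸ m<1+i = contradiction (≤-pred m<1+i) (<⇒≱ i<m)

≤-advance : ∀ x y w → w ≤ advance x y w
≤-advance x y w with x + w <? y
... | yes x+w<y = subst (w ≤_) (sym (advance-< x x+w<y)) (n≤1+n w)
... | no  x+w≮y = ≤-reflexive (sym (advance-≥ x (≮⇒≥ x+w≮y)))

shift-< : ∀ x {y z w w′} → x + w < y → w′ ≤ w + z → x + w′ < y + z
shift-< x {y} {z} {w} {w′} x+w<y w′≤w+z = begin-strict
  x + w′       ≤⟨ +-monoʳ-≤ x w′≤w+z ⟩
  x + (w + z)  ≡⟨ +-assoc x w z ⟨
  x + w + z    <⟨ +-monoˡ-< z x+w<y ⟩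
  y + z        ∎
  where open ≤-Reasoning

advance-sandwich : ∀ x y {z w w′} → w ≤ w′ × w′ ≤ w + z →
  advance x y w ≤ advance x (y + z) w′ × advance x (y + z) w′ ≤ advance x y w + z
advance-sandwich x y {z} {w} {w′} (w≤w′ , w′≤w+z) with x + w <? y | x + w′ <? y + z
... | yes x+w<y | yes _ rewrite advance-< x x+w<y | advance-< x (shift-< x x+w<y w′≤w+z) =
  s≤s w≤w′ , s≤s w′≤w+z
... | yes x+w<y | no  x+w′≮y+z = contradiction (shift-< x x+w<y w′≤w+z) x+w′≮y+z
... | no  x+w≮y | yes x+w′<y+z rewrite advance-≥ x (≮⇒≥ x+w≮y) | advance-< x x+w′<y+z =
  m≤n⇒m≤1+n w≤w′ , +-cancelˡ-≤ x _ _ (begin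
    x + suc w′   ≡⟨ +-suc x w′ ⟩
    suc x + w′   ≤⟨ x+w′<y+z ⟩
    y + z        ≤⟨ +-monoˡ-≤ z (≮⇒≥ x+w≮y) ⟩
    x + w + z    ≡⟨ +-assoc x w z ⟩
    x + (w + z)  ∎)
  where open ≤-Reasoning
... | no  x+w≮y | no  x+w′≮y+z rewrite advance-≥ x (≮⇒≥ x+w≮y) | advance-≥ x (≮⇒≥ x+w′≮y+z) =
  w≤w′ , w′≤w+z

advance-strict : ∀ x y {z w w′} → w < w′ → w′ ≤ w + z → advance x y w < advance x (y + z) w′
advance-strict x y {z} {w} {w′} w<w′ w′≤w+z with x + w <? y
... | yes x+w<y rewrite advance-< x x+w<y | advance-< x (shift-< x x+w<y w′≤w+z) = s≤s w<w′
... | no  x+w≮y rewrite advance-≥ x (≮⇒≥ x+w≮y) = <-≤-trans w<w′ (≤-advance x (y + z) w′)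

c-≤ : ∀ i m β → c i m β ≤ at β i
c-≤ i zero    β = z≤n
c-≤ i (suc m) β with i <? m
... | yes i<m rewrite c-suc β i<m = advance-≤ (at β m) (c-≤ i m β)
... | no  i≮m rewrite c-below β (≮⇒≥ i≮m) = z≤n

c-cong : ∀ {i} j β γ → 1 ≤ i → (∀ k → 1 ≤ k → k < j → at β k ≡ at γ k) → c i j β ≡ c i j γ
c-cong         zero    β γ _   _     = refl
c-cong {i} (suc j) β γ 1≤i agree with i <? j
... | no  i≮j rewrite c-below β (≮⇒≥ i≮j) | c-below γ (≮⇒≥ i≮j) = refl
... | yes i<j rewrite c-suc β i<j | c-suc γ i<j
                    | agree j (≤-trans 1≤i (<⇒≤ i<j)) ≤-refl
                    | agree i 1≤i (m≤n⇒m≤1+n i<j)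
                    | c-cong j β γ 1≤i (λ k 1≤k k<j → agree k 1≤k (m≤n⇒m≤1+n k<j)) = refl

module Shift {i z : ℕ} {β γ : Composition}
             (γ-at-i : at γ i ≡ at β i + z) (γ-after-i : ∀ k → i < k → at γ k ≡ at β k) where

  c-suc-shifted : ∀ {m} → i < m → c i (suc m) γ ≡ advance (at β m) (at β i + z) (c i m γ)
  c-suc-shifted {m} i<m rewrite c-suc γ i<m | γ-at-i | γ-after-i m i<m = refl

  c-sandwich : ∀ m → c i m β ≤ c i m γ × c i m γ ≤ c i m β + z
  c-sandwich zero = z≤n , z≤n
  c-sandwich (suc m) with i <? m
  ... | no  i≮m rewrite c-below β (≮⇒≥ i≮m) | c-below γ (≮⇒≥ i≮m) = z≤n , z≤n
  ... | yes i<m rewrite c-suc β i<m | c-suc-shifted i<m = advance-sandwich (at β m) (at β i) (c-sandwich m)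

  c-gap-suc : ∀ {m} → i < m → c i m β < c i m γ → c i (suc m) β < c i (suc m) γ
  c-gap-suc {m} i<m gap rewrite c-suc β i<m | c-suc-shifted i<m =
    advance-strict (at β m) (at β i) gap (proj₂ (c-sandwich m))

  c-gap-persists : ∀ {m m′} → i < m → m ≤′ m′ → c i m β < c i m γ → c i m′ β < c i m′ γ
  c-gap-persists i<m ≤′-refl            gap = gap
  c-gap-persists i<m (≤′-step m≤′m′) gap =
    c-gap-suc (<-≤-trans i<m (≤′⇒≤ m≤′m′)) (c-gap-persists i<m m≤′m′ gap)

  c-agree-suc-< : ∀ {m} → i < m → c i m β ≡ c i m γ → at β m + c i m β < at β i →
                  c i (suc m) β ≡ c i (suc m) γ
  c-agree-suc-< {m} i<m agree below = begin
    c i (suc m) β                                ≡⟨ c-suc β i<m ⟩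
    advance (at β m) (at β i) (c i m β)          ≡⟨ advance-< (at β m) below ⟩
    suc (c i m β)                                ≡⟨ advance-< (at β m) (≤-trans below (m≤m+n _ z)) ⟨
    advance (at β m) (at β i + z) (c i m β)      ≡⟨ cong (advance (at β m) (at β i + z)) agree ⟩
    advance (at β m) (at β i + z) (c i m γ)      ≡⟨ c-suc-shifted i<m ⟨
    c i (suc m) γ                                ∎
    where open ≡-Reasoning

  c-agree-suc-≥ : ∀ {m} → i < m → c i m β ≡ c i m γ → at β i + z ≤ at β m + c i m β →
                  c i (suc m) β ≡ c i (suc m) γ
  c-agree-suc-≥ {m} i<m agree above = begin
    c i (suc m) β                                ≡⟨ c-suc β i<m ⟩
    advance (at β m) (at β i) (c i m β)          ≡⟨ advance-≥ (at β m) (≤-trans (m≤m+n _ z) above) ⟩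
    c i m β                                      ≡⟨ advance-≥ (at β m) above ⟨
    advance (at β m) (at β i + z) (c i m β)      ≡⟨ cong (advance (at β m) (at β i + z)) agree ⟩
    advance (at β m) (at β i + z) (c i m γ)      ≡⟨ c-suc-shifted i<m ⟨
    c i (suc m) γ                                ∎
    where open ≡-Reasoning

  c-window-gap : ∀ {m m′} → i < m → c i m β ≡ c i m γ →
                 at β i ≤ at β m + c i m β → at β m + c i m β < at β i + z →
                 m < m′ → c i m′ β < c i m′ γ
  c-window-gap {m} i<m agree inside below m<m′ =
    c-gap-persists (m≤n⇒m≤1+n i<m) (≤⇒≤′ m<m′) (begin-strict
      c i (suc m) β                              ≡⟨ c-suc β i<m ⟩
      advance (at β m) (at β i) (c i m β)        ≡⟨ advance-≥ (at β m) inside ⟩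
      c i m β                                    <⟨ n<1+n _ ⟩
      suc (c i m β)                              ≡⟨ advance-< (at β m) below ⟨
      advance (at β m) (at β i + z) (c i m β)    ≡⟨ cong (advance (at β m) (at β i + z)) agree ⟩
      advance (at β m) (at β i + z) (c i m γ)    ≡⟨ c-suc-shifted i<m ⟨
      c i (suc m) γ                              ∎)
    where open ≤-Reasoning

at-map-sucs-< : ∀ (f g : ℕ → ℕ) {m k} → k < m → at (map f (map suc (applyUpTo g m))) (suc k) ≡ f (suc (g k))
at-map-sucs-< f g {suc m} {zero}  _         = refl
at-map-sucs-< f g {suc m} {suc k} (s≤s k<m) = at-map-sucs-< f (g ∘ suc) k<m

at-map-sucs-≥ : ∀ (f g : ℕ → ℕ) {m k} → m ≤ k → at (map f (map suc (applyUpTo g m))) (suc k) ≡ 0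
at-map-sucs-≥ f g {zero}          _         = refl
at-map-sucs-≥ f g {suc m} {suc k} (s≤s m≤k) = at-map-sucs-≥ f (g ∘ suc) m≤k

at-star : ∀ n α {k} → 1 ≤ k → at (star n α) k ≡ n ∸ (at α k + k)
at-star n α {suc k} _ with k <? n ∸ 1
... | yes k<n-1 = trans (at-map-sucs-< _ id k<n-1) (trans (∸-+-assoc n (suc k) (at α (suc k))) (cong (n ∸_) (+-comm (suc k) (at α (suc k)))))
... | no  k≮n-1 = trans (at-map-sucs-≥ _ id (≮⇒≥ k≮n-1)) (sym (m≤n⇒m∸n≡0 n≤k+a))
  where
  n≤k+a : n ≤ at α (suc k) + suc k
  n≤k+a = ≤-trans (m≤n+m∸n n 1) (≤-trans (s≤s (≮⇒≥ k≮n-1)) (m≤n+m _ _))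

∸-cancelˡ-≤ : ∀ {n p q} → p < n → n ∸ p ≤ n ∸ q → q ≤ p
∸-cancelˡ-≤ {n} {p} {q} p<n n∸p≤n∸q with q ≤? p
... | yes q≤p = q≤p
... | no  q≰p = contradiction n∸p≤n∸q (<⇒≱ (begin-strict
  n ∸ q      ≤⟨ ∸-monoʳ-≤ n (≰⇒> q≰p) ⟩
  n ∸ suc p  <⟨ ∸-monoʳ-< (n<1+n p) p<n ⟩
  n ∸ p      ∎))
  where open ≤-Reasoning

∸-cancelˡ-< : ∀ {n p q} → n ∸ q < n ∸ p → p < q
∸-cancelˡ-< {n} {p} {q} n∸q<n∸p with p <? q
... | yes p<q = p<q
... | no  p≮q = contradiction (∸-monoʳ-≤ n (≮⇒≥ p≮q)) (<⇒≱ n∸q<n∸p)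

c-linear : ∀ {i k} β → (∀ m → i < m → m < k → at β m + m ≤ at β i + i) →
           ∀ {m} → i < m → m ≤ k → c i m β + suc i ≡ m
c-linear {i} β before-k {suc m} i<1+m 1+m≤k with i <? m
... | no  i≮m rewrite c-below β (≮⇒≥ i≮m) = cong suc (≤-antisym (≤-pred i<1+m) (≮⇒≥ i≮m))
... | yes i<m = trans (cong (_+ suc i) (trans (c-suc β i<m) (advance-< (at β m) below))) (cong suc c+1+i≡m)
  where
  c+1+i≡m : c i m β + suc i ≡ m
  c+1+i≡m = c-linear β before-k i<m (<⇒≤ 1+m≤k)
  below : at β m + c i m β < at β i
  below = +-cancelʳ-≤ i _ _ (begin
    suc (at β m + c i m β) + i   ≡⟨ regroup (at β m) (c i m β) i ⟩
    at β m + (c i m β + suc i)   ≡⟨ cong (at β m +_) c+1+i≡m ⟩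
    at β m + m                   ≤⟨ before-k m i<m 1+m≤k ⟩
    at β i + i                   ∎)
    where
    open ≤-Reasoning
    regroup : ∀ x w i → suc (x + w) + i ≡ x + (w + suc i)
    regroup = solve-∀

point-in-window : ∀ c x {a z} → 1 ≤ z → c + x + 1 ≡ a + z → a ≤ x + c × x + c < a + z
point-in-window c x {a} {z} 1≤z eq =
  +-cancelʳ-≤ 1 a (x + c) (≤-trans (+-monoʳ-≤ a 1≤z) (≤-reflexive (trans (sym eq) (regroup c x)))) ,
  ≤-reflexive (trans (trans (+-comm 1 (x + c)) (sym (regroup c x))) eq)
  where
  regroup : ∀ c x → c + x + 1 ≡ x + c + 1
  regroup = solve-∀

InsertionPoint : Composition → ℕ → ℕ → ℕ → Set
InsertionPoint α i z j = i < j × c i j α ≡ c i j (addAt α i z) × c i j α + at α j + 1 ≡ at α i + z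

module Insertion {n : ℕ} {α : Composition} (inC : InC n α) {i z : ℕ} (1≤i : 1 ≤ i) (i≤n-1 : i ≤ n ∸ 1)
                 (1≤z : 1 ≤ z) (z≤n-i-αi : z ≤ n ∸ i ∸ at α i) where

  open InC inC

  α̂ : Composition
  α̂ = addAt α i z

  i≤length : i ≤ length α
  i≤length = subst (i ≤_) (sym len) i≤n-1

  α̂-at-i : at α̂ i ≡ at α i + z
  α̂-at-i = at-addAt-≡ α z 1≤i i≤length

  open Shift {i} {z} {α} {α̂} α̂-at-i (λ k i<k → at-addAt-≢ α i z (>⇒≢ i<k))

  module Cover {j : ℕ} (point : InsertionPoint α i z j) where

    i<j : i < j
    i<j = proj₁ point

    agree : c i j α ≡ c i j α̂
    agree = proj₁ (proj₂ point)

    eq : c i j α + at α j + 1 ≡ at α i + z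
    eq = proj₂ (proj₂ point)

    1≤j : 1 ≤ j
    1≤j = ≤-trans 1≤i (<⇒≤ i<j)

    z≤αj+1 : z ≤ at α j + 1
    z≤αj+1 = +-cancelˡ-≤ (at α i) z _ (begin
      at α i + z                ≡⟨ eq ⟨
      c i j α + at α j + 1      ≡⟨ +-assoc (c i j α) _ 1 ⟩
      c i j α + (at α j + 1)    ≤⟨ +-monoˡ-≤ _ (c-≤ i j α) ⟩
      at α i + (at α j + 1)     ∎)
      where open ≤-Reasoning

    v : ℕ
    v = at α j + 1 ∸ z

    v+z : v + z ≡ at α j + 1
    v+z = m∸n+n≡m z≤αj+1

    v≤αj : v ≤ at α j
    v≤αj = +-cancelʳ-≤ 1 v _ (≤-trans (+-monoʳ-≤ v 1≤z) (≤-reflexive v+z))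

    writable : length α̂ < j → v ≡ 0
    writable len<j rewrite at-beyond-length α (subst (_< j) (length-addAt α i z) len<j) = m≤n⇒m∸n≡0 1≤z

    α″ : Composition
    α″ = setAt α̂ j v

    α″-at-j : at α″ j ≡ v
    α″-at-j = at-setAt-≡ α̂ j v 1≤j writable

    α″-at-i : at α″ i ≡ at α i + z
    α″-at-i = trans (at-setAt-≢ α̂ j v (<⇒≢ i<j)) α̂-at-i

    α″-elsewhere : ∀ {k} → k ≢ i → k ≢ j → at α″ k ≡ at α k
    α″-elsewhere k≢i k≢j = trans (at-setAt-≢ α̂ j v k≢j) (at-addAt-≢ α i z k≢i)

    bound″ : ∀ k → 1 ≤ k → k ≤ n ∸ 1 → at α″ k ≤ n ∸ k
    bound″ k 1≤k k≤n-1 with k ≟ j | k ≟ i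
    ... | yes refl | _        = subst (_≤ n ∸ k) (sym α″-at-j) (≤-trans v≤αj (bound k 1≤k k≤n-1))
    ... | no  _    | yes refl = subst (_≤ n ∸ k) (sym α″-at-i)
                                  (≤-trans (+-monoʳ-≤ (at α i) z≤n-i-αi) (≤-reflexive (m+[n∸m]≡n (bound i 1≤i i≤n-1))))
    ... | no  k≢j  | no  k≢i  = subst (_≤ n ∸ k) (sym (α″-elsewhere k≢i k≢j)) (bound k 1≤k k≤n-1)

    inC″ : InC n α″
    inC″ = record { len = trans (length-setAt α̂ j v) (trans (length-addAt α i z) len) ; bound = bound″ }

    sum″ : sum α″ ≡ suc (sum α)
    sum″ = +-cancelʳ-≡ (at α j) _ _ (begin
      sum α″ + at α j           ≡⟨ cong (sum α″ +_) (at-addAt-≢ α i z (>⇒≢ i<j)) ⟨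
      sum α″ + at α̂ j           ≡⟨ sum-setAt α̂ j v 1≤j writable ⟩
      sum α̂ + v                 ≡⟨ cong (_+ v) (sum-addAt α z 1≤i i≤length) ⟩
      sum α + z + v             ≡⟨ +-assoc (sum α) z v ⟩
      sum α + (z + v)           ≡⟨ cong (sum α +_) (trans (+-comm z v) v+z) ⟩
      sum α + (at α j + 1)      ≡⟨ regroup (sum α) (at α j) ⟩
      suc (sum α) + at α j      ∎)
      where
      open ≡-Reasoning
      regroup : ∀ s x → s + (x + 1) ≡ suc s + x
      regroup = solve-∀

    moved-total : at α j + at α i + 1 ≡ v + (at α i + z)
    moved-total = begin
      at α j + at α i + 1       ≡⟨ regroup (at α j) (at α i) ⟩
      at α i + (at α j + 1)     ≡⟨ cong (at α i +_) v+z ⟨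
      at α i + (v + z)          ≡⟨ +-assoc (at α i) v z ⟨
      at α i + v + z            ≡⟨ cong (_+ z) (+-comm (at α i) v) ⟩
      v + at α i + z            ≡⟨ +-assoc v (at α i) z ⟩
      v + (at α i + z)          ∎
      where
      open ≡-Reasoning
      regroup : ∀ x a → x + a + 1 ≡ a + (x + 1)
      regroup = solve-∀

    c+v≡αi : c i j α + v ≡ at α i
    c+v≡αi = +-cancelʳ-≡ z _ _ (begin
      c i j α + v + z           ≡⟨ +-assoc (c i j α) v z ⟩
      c i j α + (v + z)         ≡⟨ cong (c i j α +_) v+z ⟩
      c i j α + (at α j + 1)    ≡⟨ +-assoc (c i j α) (at α j) 1 ⟨
      c i j α + at α j + 1      ≡⟨ eq ⟩
      at α i + z                ∎)
      where open ≡-Reasoning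

    covers : Covers α″ α
    covers = sum″ , i , j , 1≤i , i<j
           , subst (suc (at α i) ≤_) (sym α″-at-i) (m<m+n (at α i) 1≤z)
           , subst₂ (λ p q → at α j + at α i + 1 ≡ p + q) (sym α″-at-j) (sym α″-at-i) moved-total
           , (λ k _ k≢i k≢j → sym (α″-elsewhere k≢i k≢j))
           , trans (c-cong j α″ α̂ 1≤i (λ k _ k<j → at-setAt-≢ α̂ j v (<⇒≢ k<j))) (sym agree)
           , subst (λ p → c i j α + p ≡ at α i) (sym α″-at-j) c+v≡αi

  insertionPoint⇒insertable : ∀ {j} → InsertionPoint α i z j → Insertable n α i z
  insertionPoint⇒insertable point = α″ , inC″ , α″-at-i , covers
    where open Cover point

  insertable⇒insertionPoint : Insertable n α i z → Σ ℕ (InsertionPoint α i z)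
  insertable⇒insertionPoint (α″ , _ , α″-at-i , _ , i′ , j , _ , i′<j , grows , moved , fixed , same-c , c+α″j)
    with i′ ≟ i
  ... | yes refl = j , i′<j , trans (sym same-c) (c-cong j α″ α̂ 1≤i agree-below) , eq
    where
    agree-below : ∀ k → 1 ≤ k → k < j → at α″ k ≡ at α̂ k
    agree-below k 1≤k k<j with k ≟ i
    ... | yes refl = trans α″-at-i (sym α̂-at-i)
    ... | no  k≢i  = trans (sym (fixed k 1≤k k≢i (<⇒≢ k<j))) (sym (at-addAt-≢ α i z k≢i))
    eq : c i j α + at α j + 1 ≡ at α i + z
    eq = +-cancelʳ-≡ (at α i) _ _ (begin
      c i j α + at α j + 1 + at α i          ≡⟨ regroup (c i j α) (at α j) (at α i) ⟩
      c i j α + (at α j + at α i + 1)        ≡⟨ cong (c i j α +_) moved ⟩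
      c i j α + (at α″ j + at α″ i)          ≡⟨ +-assoc (c i j α) _ _ ⟨
      c i j α + at α″ j + at α″ i            ≡⟨ cong₂ _+_ c+α″j α″-at-i ⟩
      at α i + (at α i + z)                  ≡⟨ +-comm (at α i) _ ⟩
      at α i + z + at α i                    ∎)
      where
      open ≡-Reasoning
      regroup : ∀ c x a → c + x + 1 + a ≡ c + (x + a + 1)
      regroup = solve-∀
  ... | no i′≢i with j ≟ i
  ...   | no  j≢i  = contradiction (trans (fixed i 1≤i (i′≢i ∘ sym) (j≢i ∘ sym)) α″-at-i)
                                   (<⇒≢ (m<m+n (at α i) 1≤z))
  ...   | yes refl = contradiction moved (<⇒≢ (begin-strict
      at α i + at α i′ + 1                   ≡⟨ +-assoc (at α i) _ 1 ⟩
      at α i + (at α i′ + 1)                 ≡⟨ cong (at α i +_) (+-comm _ 1) ⟩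
      at α i + suc (at α i′)                 ≤⟨ +-monoʳ-≤ (at α i) grows ⟩
      at α i + at α″ i′                      <⟨ +-monoˡ-< (at α″ i′) (m<m+n (at α i) 1≤z) ⟩
      at α i + z + at α″ i′                  ≡⟨ cong (_+ at α″ i′) α″-at-i ⟨
      at α″ i + at α″ i′                     ∎))
    where open ≤-Reasoning

  insertionPoint-gap : ∀ {j} → InsertionPoint α i z j → ∀ {m} → j < m → c i m α < c i m α̂
  insertionPoint-gap {j} (i<j , agree , eq) = c-window-gap i<j agree (proj₁ window) (proj₂ window)
    where
    window : at α i ≤ at α j + c i j α × at α j + c i j α < at α i + z
    window = point-in-window (c i j α) (at α j) 1≤z eq

  insertionPoint≡Jhat : ∀ {j J} → InsertionPoint α i z j → IsJhat α i z J → j ≡ J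
  insertionPoint≡Jhat point@(i<j , agree , _) ((_ , agree-J) , J-max) =
    ≤-antisym (J-max _ i<j agree) (≮⇒≥ (λ j<J → <-irrefl agree-J (insertionPoint-gap point j<J)))

  insertable⇔ : ∀ J → IsJhat α i z J → Insertable n α i z ⇔ (c i J α + at α J + 1 ≡ at α i + z)
  insertable⇔ J isJhat@((i<J , agree-J) , _) =
    mk⇔ equation-at-J (λ eq → insertionPoint⇒insertable (i<J , agree-J , eq))
    where
    equation-at-J : Insertable n α i z → c i J α + at α J + 1 ≡ at α i + z
    equation-at-J ins with insertable⇒insertionPoint ins
    ... | j , point@(_ , _ , eq) =
      subst (λ t → c i t α + at α t + 1 ≡ at α i + z) (insertionPoint≡Jhat point isJhat) eq

  αi+i<n : at α i + i < n
  αi+i<n = 0<m∸n⇒n<m (subst (0 <_) (trans (∸-+-assoc n i (at α i)) (cong (n ∸_) (+-comm i (at α i))))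
                                    (≤-trans 1≤z z≤n-i-αi))

  module _ {k : ℕ} (isKstar : IsKstar n α i k) where

    i<k : i < k
    i<k = proj₁ (proj₁ isKstar)

    k-min : ∀ m → i < m → at (star n α) m < at (star n α) i → k ≤ m
    k-min = proj₂ isKstar

    1≤k : 1 ≤ k
    1≤k = ≤-trans 1≤i (<⇒≤ i<k)

    jumps-at-k : at α i + i < at α k + k
    jumps-at-k = ∸-cancelˡ-< (subst₂ _<_ (at-star n α 1≤k) (at-star n α 1≤i) (proj₂ (proj₁ isKstar)))

    flat-before-k : ∀ m → i < m → m < k → at α m + m ≤ at α i + i
    flat-before-k m i<m m<k = ∸-cancelˡ-≤ αi+i<n
      (subst₂ _≤_ (at-star n α 1≤i) (at-star n α (≤-trans 1≤i (<⇒≤ i<m)))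
        (≮⇒≥ (λ α*m<α*i → <⇒≱ m<k (k-min m i<m α*m<α*i))))

    c-α-linear : ∀ {m} → i < m → m ≤ k → c i m α + suc i ≡ m
    c-α-linear = c-linear α flat-before-k

    c-α̂-linear : ∀ {m} → i < m → m ≤ k → c i m α̂ + suc i ≡ m
    c-α̂-linear = c-linear α̂ (λ m i<m m<k → begin
      at α̂ m + m            ≡⟨ cong (_+ m) (at-addAt-≢ α i z (>⇒≢ i<m)) ⟩
      at α m + m            ≤⟨ flat-before-k m i<m m<k ⟩
      at α i + i            ≤⟨ +-monoˡ-≤ i (m≤m+n (at α i) z) ⟩
      at α i + z + i        ≡⟨ cong (_+ i) α̂-at-i ⟨
      at α̂ i + i            ∎)
      where open ≤-Reasoning

    index-via-c : ∀ {m} → i < m → m ≤ k → at α m + m ≡ suc (at α m + c i m α) + i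
    index-via-c {m} i<m m≤k = trans (cong (at α m +_) (sym (c-α-linear i<m m≤k))) (regroup (at α m) (c i m α) i)
      where
      regroup : ∀ x c i → x + (c + suc i) ≡ suc (x + c) + i
      regroup = solve-∀

    insertionPoint-bound : ∀ {j} → InsertionPoint α i z j → z + at α i + i ≤ at α k + k
    insertionPoint-bound {j} (i<j , agree , eq) with k <? j
    ... | yes k<j with at α k + c i k α <? at α i + z
    ...   | yes below = contradiction agree (<⇒≢ (c-window-gap i<k agree-at-k inside below k<j))
      where
      agree-at-k : c i k α ≡ c i k α̂
      agree-at-k = +-cancelʳ-≡ (suc i) _ _ (trans (c-α-linear i<k ≤-refl) (sym (c-α̂-linear i<k ≤-refl)))
      inside : at α i ≤ at α k + c i k α
      inside = ≤-pred (+-cancelʳ-≤ i _ _ (≤-trans jumps-at-k (≤-reflexive (index-via-c i<k ≤-refl))))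
    ...   | no  ¬below = begin
      z + at α i + i            ≡⟨ cong (_+ i) (+-comm z (at α i)) ⟩
      at α i + z + i            ≤⟨ +-monoˡ-≤ i (≮⇒≥ ¬below) ⟩
      at α k + c i k α + i      ≤⟨ n≤1+n _ ⟩
      suc (at α k + c i k α) + i ≡⟨ index-via-c i<k ≤-refl ⟨
      at α k + k                ∎
      where open ≤-Reasoning
    insertionPoint-bound {j} (i<j , agree , eq) | no k≮j = begin
      z + at α i + i            ≡⟨ cong (_+ i) (trans (+-comm z (at α i)) (trans (sym eq) (regroup (c i j α) (at α j)))) ⟩
      suc (at α j + c i j α) + i ≡⟨ index-via-c i<j (≮⇒≥ k≮j) ⟨
      at α j + j                ≤⟨ reaches-k (m≤n⇒m<n∨m≡n (≮⇒≥ k≮j)) ⟩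
      at α k + k                ∎
      where
      open ≤-Reasoning
      regroup : ∀ c x → c + x + 1 ≡ suc (x + c)
      regroup = solve-∀
      reaches-k : j < k ⊎ j ≡ k → at α j + j ≤ at α k + k
      reaches-k (inj₁ j<k)  = ≤-trans (flat-before-k j i<j j<k) (<⇒≤ jumps-at-k)
      reaches-k (inj₂ refl) = ≤-refl

  insertable⇒bound : Insertable n α i z → ∀ k → IsKstar n α i k → z + at α i + i ≤ at α k + k
  insertable⇒bound ins k isKstar = insertionPoint-bound isKstar (proj₂ (insertable⇒insertionPoint ins))

  module _ (z≡1 : z ≡ 1) where

    -- Invariant: α_i − c_{i,m}(α) ≤ n − m, which forces a hit by the time m reaches n, where α_n = 0.
    search : ∀ d {m} → d + m ≡ n → i < m → c i m α ≡ c i m α̂ → at α i + m ≤ c i m α + n →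
             Σ ℕ (InsertionPoint α i z)
    search zero {m} refl i<n agree room = n , i<n , agree , (begin
      c i n α + at α n + 1      ≡⟨ cong (λ t → c i n α + t + 1) αn≡0 ⟩
      c i n α + 0 + 1           ≡⟨ cong (_+ 1) (trans (+-identityʳ _) c≡αi) ⟩
      at α i + 1                ≡⟨ cong (at α i +_) z≡1 ⟨
      at α i + z                ∎)
      where
      open ≡-Reasoning
      αn≡0 : at α n ≡ 0
      αn≡0 = at-beyond-length α (subst (_< n) (sym len) (∸-monoʳ-< {o = 0} z<s (≤-trans 1≤i (<⇒≤ i<n))))
      c≡αi : c i n α ≡ at α i
      c≡αi = ≤-antisym (c-≤ i n α) (+-cancelʳ-≤ n _ _ room)
    search (suc d) {m} d+m≡n i<m agree room with <-cmp (at α m + c i m α) (at α i)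
    ... | tri≈ _ hit _ = m , i<m , agree , (begin
      c i m α + at α m + 1      ≡⟨ cong (_+ 1) (trans (+-comm (c i m α) _) hit) ⟩
      at α i + 1                ≡⟨ cong (at α i +_) z≡1 ⟨
      at α i + z                ∎)
      where open ≡-Reasoning
    ... | tri< below _ _ = search d (trans (+-suc d m) d+m≡n) (m≤n⇒m≤1+n i<m)
      (c-agree-suc-< i<m agree below)
      (subst (λ t → at α i + suc m ≤ t + n) (sym (trans (c-suc α i<m) (advance-< (at α m) below)))
        (≤-trans (≤-reflexive (+-suc (at α i) m)) (s≤s room)))
    ... | tri> _ _ above = search d (trans (+-suc d m) d+m≡n) (m≤n⇒m≤1+n i<m)
      (c-agree-suc-≥ i<m agree (subst (λ t → at α i + t ≤ _) (sym z≡1) (≤-trans (≤-reflexive (+-comm _ 1)) above)))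
      (subst (λ t → at α i + suc m ≤ t + n) (sym (trans (c-suc α i<m) (advance-≥ (at α m) (<⇒≤ above))))
        (begin
          at α i + suc m                ≡⟨ +-suc (at α i) m ⟩
          suc (at α i) + m              ≤⟨ +-monoˡ-≤ m above ⟩
          at α m + c i m α + m          ≤⟨ +-monoˡ-≤ m (+-monoˡ-≤ (c i m α) αm≤n-m) ⟩
          n ∸ m + c i m α + m           ≡⟨ regroup ⟩
          c i m α + n                   ∎))
      where
      open ≤-Reasoning
      m<n : m < n
      m<n = subst (m <_) d+m≡n (m<n+m m z<s)
      αm≤n-m : at α m ≤ n ∸ m
      αm≤n-m = bound m (≤-trans 1≤i (<⇒≤ i<m)) (m+n≤o⇒m≤o∸n m (subst (_≤ n) (+-comm 1 m) m<n))
      regroup : n ∸ m + c i m α + m ≡ c i m α + n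
      regroup = trans (swap (n ∸ m) (c i m α) m) (cong (c i m α +_) (m∸n+n≡m (<⇒≤ m<n)))
        where
        swap : ∀ r c m → r + c + m ≡ c + (r + m)
        swap = solve-∀

    insertable-z≡1 : Insertable n α i z
    insertable-z≡1 = insertionPoint⇒insertable (proj₂ (search (n ∸ suc i) (m∸n+n≡m i<n) ≤-refl
      (trans (c-below {i} α ≤-refl) (sym (c-below {i} α̂ ≤-refl)))
      (subst (λ t → at α i + suc i ≤ t + n) (sym (c-below {i} α ≤-refl))
        (≤-trans (≤-reflexive (+-suc (at α i) i)) αi+i<n))))
      where
      i<n : i < n
      i<n = ≤-trans (s≤s (m≤n+m i (at α i))) αi+i<n

insertable-by-one : ∀ {n α i} → InC n α → 1 ≤ i → i ≤ n ∸ 1 → at α i + i < n → Insertable n α i 1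
insertable-by-one {n} {α} {i} inC 1≤i i≤n-1 αi+i<n =
  Insertion.insertable-z≡1 inC 1≤i i≤n-1 ≤-refl room refl
  where
  room : 1 ≤ n ∸ i ∸ at α i
  room = subst (1 ≤_) (sym (∸-+-assoc n i (at α i))) (m+n≤o⇒m≤o∸n 1 (subst (_< n) (+-comm (at α i) i) αi+i<n))

proposition3p12 : ∀ (n : ℕ) (α : Composition) (i z : ℕ) →
    InC n α → 1 ≤ i → i ≤ n ∸ 1 → 1 ≤ z → z ≤ n ∸ i ∸ at α i →
    -- (i)
    (∀ J → IsJhat α i z J →
      (Insertable n α i z ⇔ (c i J α + at α J + 1 ≡ at α i + z)))
    -- (ii)
    × (Insertable n α i z → ∀ k → IsKstar n α i k →
        z + at α i + i ≤ at α k + k)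
    -- (iii)
    × (at α i + i < n → Insertable n α i 1)
proposition3p12 n α i z inC 1≤i i≤n-1 1≤z z≤n-i-αi =
  insertable⇔ , insertable⇒bound , insertable-by-one inC 1≤i i≤n-1
  where open Insertion inC 1≤i i≤n-1 1≤z z≤n-i-αi
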